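{- Let $G$ be a finite simple connected graph that is $(P_5, K_1\cup K_3)$-free (i.e. has no induced subgraph isomorphic to the path $P_5$ on five vertices, nor to the disjoint union of a single vertex and a triangle). Suppose that $G$ has a non-dominating $5$-hole. Then for each non-dominating $5$-hole $C=v_1v_2v_3v_4v_5v_1$ of $G$, $V(G)$ is partitioned into the four subsets $V(C)\cup \mathcal{N}^{(2)}(C)$, $\mathcal{N}^{(3)}(C)$, $N_{\{1,2,3,4,5\}}(C)$ and $M(C)$, and these have the following properties: (a) $G[V(C)\cup \mathcal{N}^{(2)}(C)]$ is a blow up of $C$, and $G[V(C)\cup \mathcal{N}^{(2)}(C)\cup \mathcal{N}^{(3)}(C)]$ is a blow up of a subgraph of $\mathcal{F}$; (b) $M(C)\cup V(C)\cup \mathcal{N}^{(2)}(C)$ is complete to $N_{\{1,2,3,4,5\}}(C)$; (c) $M(C)$ is anticomplete to $V(C)\cup \mathcal{N}^{(2)}(C)$ but complete to $\mathcal{N}^{(3)}(C)$, and $M(C)$ is an independent set if $\mathcal{N}^{(3)}(C)\neq\emptyset$.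
   Context: All graphs are finite and simple. A $k$-hole is an induced cycle of length $k\ge 4$. For a $5$-hole $C=v_1v_2v_3v_4v_5v_1$, indices are taken modulo $5$; $N(C)$ is the set of vertices not in $V(C)$ having a neighbor in $V(C)$, and $M(C)=V(G)\setminus (V(C)\cup N(C))$. The hole $C$ is non-dominating if $M(C)\neq\emptyset$. For $T\subseteq\{1,\dots,5\}$, $N_T(C)=\{x\in N(C): xv_i\in E(G) \text{ iff } i\in T\}$. Define $\mathcal{N}^{(2)}(C)=\bigcup_{i=1}^5 N_{\{i,i+2\}}(C)$ and $\mathcal{N}^{(3)}(C)=\bigcup_{i=1}^5 (N_{\{i,i+1,i+2\}}(C)\cup N_{\{i,i+1,i+3\}}(C))$. A set $X$ is complete (anticomplete) to a set $Y$ if every vertex of $X$ is adjacent (non-adjacent) to every vertex of $Y$. A graph $F$ is a blow up of a graph $H$ if $F$ is obtained from $H$ by replacing each vertex by an independent set and each edge by a complete bipartite graph between the corresponding sets. $\mathcal{F}$ is the graph obtained from two disjoint $5$-cycles $x_1x_2x_3x_4x_5x_1$ and $y_1y_2y_3y_4y_5y_1$ by adding the edges $x_iy_i, x_iy_{i+1}, x_iy_{i+3}$ for $1\le i\le 5$ (indices mod $5$). -}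

module Defs where

open import Data.Nat using (ℕ; zero; suc)
open import Data.Fin using (Fin; zero; suc) renaming (_≟_ to _≟F_)
open import Data.Bool using (Bool; true; false; _∨_; _∧_; not)
open import Data.Product using (Σ; ∃; _×_; _,_)
open import Data.Sum using (_⊎_)
open import Data.Empty using (⊥)
open import Data.Unit using (⊤)
open import Relation.Nullary using (¬_)
open import Relation.Nullary.Decidable using (⌊_⌋)
open import Relation.Binary.PropositionalEquality using (_≡_)
open import Function.Definitions using (Injective)

record Graph (n : ℕ) : Set where
  field
    E     : Fin n → Fin n → Bool
    sym   : ∀ x y → E x y ≡ E y x
    irrefl : ∀ x → E x x ≡ false
open Graph public

data Reach {n : ℕ} (G : Graph n) : Fin n → Fin n → Set where
  here : ∀ {x} → Reach G x x
  step : ∀ {x y z} → E G x y ≡ true → Reach G y z → Reach G x z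

Connected : ∀ {n} → Graph n → Set
Connected G = ∀ x y → Reach G x y

HasInduced : ∀ {n k} → Graph n → (Fin k → Fin k → Bool) → Set
HasInduced {n} {k} G H =
  Σ (Fin k → Fin n) λ f → Injective _≡_ _≡_ f × (∀ i j → E G (f i) (f j) ≡ H i j)

_==_ : ∀ {k} → Fin k → Fin k → Bool
i == j = ⌊ i ≟F j ⌋

-- indices mod 5 (v_1,...,v_5 correspond to 0,...,4)
suc5 : Fin 5 → Fin 5
suc5 zero = suc zero
suc5 (suc zero) = suc (suc zero)
suc5 (suc (suc zero)) = suc (suc (suc zero))
suc5 (suc (suc (suc zero))) = suc (suc (suc (suc zero)))
suc5 (suc (suc (suc (suc zero)))) = zero

_⊕_ : Fin 5 → ℕ → Fin 5
i ⊕ zero = i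
i ⊕ suc k = suc5 (i ⊕ k)

C5 : Fin 5 → Fin 5 → Bool
C5 i j = (j == (i ⊕ 1)) ∨ (i == (j ⊕ 1))

P5 : Fin 5 → Fin 5 → Bool
P5 i j = (j == (i ⊕ 1) ∧ not (i == (suc (suc (suc (suc zero))))))
       ∨ (i == (j ⊕ 1) ∧ not (j == (suc (suc (suc (suc zero))))))

K1∪K3 : Fin 4 → Fin 4 → Bool
K1∪K3 zero _ = false
K1∪K3 (suc _) zero = false
K1∪K3 (suc i) (suc j) = not (i == j)

record Hole {n : ℕ} (G : Graph n) : Set where
  field
    v     : Fin 5 → Fin n
    v-inj : Injective _≡_ _≡_ v
    v-ind : ∀ i j → E G (v i) (v j) ≡ C5 i j
open Hole public

module _ {n : ℕ} {G : Graph n} (C : Hole G) where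

  InC : Fin n → Set
  InC x = ∃ λ i → v C i ≡ x

  InN : Fin n → Set
  InN x = ¬ InC x × ∃ λ i → E G x (v C i) ≡ true

  InM : Fin n → Set
  InM x = ¬ InC x × ¬ InN x

  InNT : (Fin 5 → Bool) → Fin n → Set
  InNT T x = InN x × (∀ i → E G x (v C i) ≡ T i)

  InN2 : Fin n → Set
  InN2 x = ∃ λ i → InNT (λ j → (j == i) ∨ (j == (i ⊕ 2))) x

  InN3 : Fin n → Set
  InN3 x = ∃ λ i →
      InNT (λ j → (j == i) ∨ (j == (i ⊕ 1)) ∨ (j == (i ⊕ 2))) x
    ⊎ InNT (λ j → (j == i) ∨ (j == (i ⊕ 1)) ∨ (j == (i ⊕ 3))) x

  InN5 : Fin n → Set
  InN5 x = InNT (λ _ → true) x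

NonDominating : ∀ {n} {G : Graph n} → Hole G → Set
NonDominating C = ∃ λ x → InM C x

record Partition4 {n : ℕ} (A B C D : Fin n → Set) : Set where
  field
    cover : ∀ x → A x ⊎ B x ⊎ C x ⊎ D x
    disjAB : ∀ x → A x → B x → ⊥
    disjAC : ∀ x → A x → C x → ⊥
    disjAD : ∀ x → A x → D x → ⊥
    disjBC : ∀ x → B x → C x → ⊥
    disjBD : ∀ x → B x → D x → ⊥
    disjCD : ∀ x → C x → D x → ⊥

-- G[S] is a blow up of the graph H on vertex type V (with adjacency HE,
-- and vertex set given by the predicate HV): each vertex u of H is replaced by
-- the nonempty independent set φ⁻¹(u), each edge by a complete bipartite graph.
IsBlowUpOf : ∀ {n} → Graph n → (Fin n → Set) →
             {V : Set} → (V → Set) → (V → V → Bool) → Set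
IsBlowUpOf {n} G S {V} HV HE =
  Σ ((x : Fin n) → S x → V) λ φ →
      (∀ x (s : S x) → HV (φ x s))
    × (∀ u → HV u → ∃ λ x → Σ (S x) λ s → φ x s ≡ u)
    × (∀ x y (s : S x) (t : S y) → E G x y ≡ HE (φ x s) (φ y t))

data FV : Set where
  X Y : Fin 5 → FV

Fadj : FV → FV → Bool
Fadj (X i) (X j) = C5 i j
Fadj (Y i) (Y j) = C5 i j
Fadj (X i) (Y j) = (j == i) ∨ (j == (i ⊕ 1)) ∨ (j == (i ⊕ 3))
Fadj (Y j) (X i) = (j == i) ∨ (j == (i ⊕ 1)) ∨ (j == (i ⊕ 3))

-- a (not necessarily induced) subgraph of 𝓕
record SubgraphF : Set₁ where
  field
    HV     : FV → Set
    HE     : FV → FV → Bool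
    HE-sym : ∀ u w → HE u w ≡ HE w u
    HE-sub : ∀ u w → HE u w ≡ true → Fadj u w ≡ true
    HE-ver : ∀ u w → HE u w ≡ true → HV u × HV w
open SubgraphF public

IsBlowUpOfC5 : ∀ {n} → Graph n → (Fin n → Set) → Set
IsBlowUpOfC5 G S = IsBlowUpOf G S {Fin 5} (λ _ → ⊤) C5

IsBlowUpOfSubgraphOfF : ∀ {n} → Graph n → (Fin n → Set) → Set₁
IsBlowUpOfSubgraphOfF G S = Σ SubgraphF λ H → IsBlowUpOf G S (HV H) (HE H)

module Submission where

-- The trace of a vertex x on the hole C is the set of v_i adjacent to x. If x sees both
-- ends of an edge v_i v_{i+1}, it must see v_{i+3}, as otherwise v_{i+3} is isolated from
-- the triangle x v_i v_{i+1}; if x sees v_i but none of v_{i+2}, v_{i+3}, v_{i+4}, then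
-- v_{i+2} v_{i+3} v_{i+4} v_i x is an induced P₅. The only traces surviving these two rules
-- are ∅, {i, i+2}, {i, i+1, i+3} and everything, which gives the partition. Every remaining
-- adjacency is forced in the same way: the opposite value would create an induced P₅ or a
-- triangle with a vertex anticomplete to it, that vertex often being taken from M(C). All
-- statements are invariant under rotating C, so each is checked only for traces based at
-- v_0, by case analysis over the position of the second trace.

open import Defs
open import Data.Nat using (ℕ)
open import Data.Bool using (Bool; true; false; _∧_; _∨_)
open import Data.Bool.Properties
  using (¬-not; not-¬; ∧-comm; ∧-identityʳ; ∧-conicalˡ; ∧-conicalʳ) renaming (_≟_ to _≟ᵇ_)
open import Data.Fin using (Fin; toℕ) renaming (_≟_ to _≟ᶠ_)
open import Data.Fin.Patterns using (0F; 1F; 2F; 3F; 4F)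
open import Data.Fin.Properties using (all?; any?)
open import Data.Product using (Σ; ∃; ∃-syntax; _×_; _,_)
open import Data.Sum using (_⊎_; inj₁; inj₂; map₁)
open import Data.Empty using (⊥; ⊥-elim)
open import Data.Unit using (tt)
open import Function using (_∘_; const; case_of_)
open import Function.Definitions using (Injective)
open import Relation.Nullary using (¬_; Dec; yes; no; does)
open import Relation.Nullary.Decidable using (from-yes; ¬?; _→-dec_; _×-dec_; dec-true)
open import Relation.Binary.PropositionalEquality as ≡ using (_≡_; refl; trans; cong; cong₂; _≗_)

-- v (rebase C i) a = v C (i ⊞ a): the hole C rotated so that v_i becomes v_0.
_⊞_ : Fin 5 → Fin 5 → Fin 5
i ⊞ a = i ⊕ toℕ a

T₂ T₃ T₃′ : Fin 5 → Fin 5 → Bool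
T₂ i a = (a == i) ∨ (a == (i ⊕ 2))
T₃ i a = (a == i) ∨ (a == (i ⊕ 1)) ∨ (a == (i ⊕ 2))
T₃′ i a = (a == i) ∨ (a == (i ⊕ 1)) ∨ (a == (i ⊕ 3))

Equivariant : (Fin 5 → Fin 5 → Bool) → Set
Equivariant P = ∀ i k a → P (i ⊞ k) (i ⊞ a) ≡ P k a

equivariant? : ∀ P → Dec (Equivariant P)
equivariant? P = all? λ i → all? λ k → all? λ a → P (i ⊞ k) (i ⊞ a) ≟ᵇ P k a

Disjoint : (Fin 5 → Fin 5 → Bool) → (Fin 5 → Fin 5 → Bool) → Set
Disjoint P Q = ∀ i j → ¬ (P i ≗ Q j)

disjoint? : ∀ P Q → Dec (Disjoint P Q)
disjoint? P Q = all? λ i → all? λ j → ¬? (all? λ a → P i a ≟ᵇ Q j a)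

⊞-injective : ∀ i {a b} → i ⊞ a ≡ i ⊞ b → a ≡ b
⊞-injective i = from-yes (all? λ i → all? λ a → all? λ b → (i ⊞ a ≟ᶠ i ⊞ b) →-dec (a ≟ᶠ b)) i _ _

offset : ∀ i j → ∃[ k ] i ⊞ k ≡ j
offset = from-yes (all? λ i → all? λ j → any? λ k → i ⊞ k ≟ᶠ j)

C5-sym : ∀ a b → C5 a b ≡ C5 b a
C5-sym = from-yes (all? λ a → all? λ b → C5 a b ≟ᵇ C5 b a)

C5-equivariant : Equivariant C5
C5-equivariant = from-yes (equivariant? C5)

T₂-equivariant : Equivariant T₂
T₂-equivariant = from-yes (equivariant? T₂)

T₃-equivariant : Equivariant T₃
T₃-equivariant = from-yes (equivariant? T₃)

T₃′-equivariant : Equivariant T₃′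
T₃′-equivariant = from-yes (equivariant? T₃′)

shifted-C5-equivariant : Equivariant (λ i j → C5 (i ⊕ 1) (j ⊕ 1))
shifted-C5-equivariant = from-yes (equivariant? λ i j → C5 (i ⊕ 1) (j ⊕ 1))

shifted-F-equivariant : Equivariant (λ i j → Fadj (Y (i ⊕ 1)) (X (j ⊕ 1)))
shifted-F-equivariant = from-yes (equivariant? λ i j → Fadj (Y (i ⊕ 1)) (X (j ⊕ 1)))

-- A vertex of N_{j,j+2} sees C as v_{j+1} does, and one of N_{j,j+1,j+3} sees C as
-- y_{j+1} of 𝓕 sees the x_a; this dictates the blow-up maps.
T₂-row : ∀ j a → T₂ j a ≡ C5 (j ⊕ 1) a
T₂-row = from-yes (all? λ j → all? λ a → T₂ j a ≟ᵇ C5 (j ⊕ 1) a)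

T₃′-row : ∀ j a → T₃′ j a ≡ Fadj (Y (j ⊕ 1)) (X a)
T₃′-row = from-yes (all? λ j → all? λ a → T₃′ j a ≟ᵇ Fadj (Y (j ⊕ 1)) (X a))

T₂-T₃′-disjoint : Disjoint T₂ T₃′
T₂-T₃′-disjoint = from-yes (disjoint? T₂ T₃′)

T₂-complete-disjoint : Disjoint T₂ (λ _ _ → true)
T₂-complete-disjoint = from-yes (disjoint? T₂ λ _ _ → true)

T₃′-complete-disjoint : Disjoint T₃′ (λ _ _ → true)
T₃′-complete-disjoint = from-yes (disjoint? T₃′ λ _ _ → true)

C5-T₃′-disjoint : Disjoint C5 T₃′
C5-T₃′-disjoint = from-yes (disjoint? C5 T₃′)

Shape : (Fin 5 → Bool) → Set
Shape τ = (∃[ i ] τ ≗ T₂ i) ⊎ (∃[ i ] τ ≗ T₃′ i) ⊎ τ ≗ const true ⊎ τ ≗ const false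

pointwise : ∀ {τ T : Fin 5 → Bool} →
  τ 0F ≡ T 0F → τ 1F ≡ T 1F → τ 2F ≡ T 2F → τ 3F ≡ T 3F → τ 4F ≡ T 4F → τ ≗ T
pointwise e₀ e₁ e₂ e₃ e₄ = λ { 0F → e₀ ; 1F → e₁ ; 2F → e₂ ; 3F → e₃ ; 4F → e₄ }

trace-shape : ∀ τ →
  (∀ i → τ i ≡ true → τ (i ⊕ 1) ≡ true → τ (i ⊕ 3) ≡ false → ⊥) →
  (∀ i → τ i ≡ true → τ (i ⊕ 2) ≡ false → τ (i ⊕ 3) ≡ false → τ (i ⊕ 4) ≡ false → ⊥) →
  Shape τ
trace-shape τ triangle path with τ 0F in e₀ | τ 1F in e₁ | τ 2F in e₂ | τ 3F in e₃ | τ 4F in e₄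
... | false | false | false | false | false = inj₂ (inj₂ (inj₂ (pointwise e₀ e₁ e₂ e₃ e₄)))
... | false | false | false | false | true = ⊥-elim (path 4F e₄ e₁ e₂ e₃)
... | false | false | false | true | false = ⊥-elim (path 3F e₃ e₀ e₁ e₂)
... | false | false | false | true | true = ⊥-elim (triangle 3F e₃ e₄ e₁)
... | false | false | true | false | false = ⊥-elim (path 2F e₂ e₄ e₀ e₁)
... | false | false | true | false | true = inj₁ (2F , pointwise e₀ e₁ e₂ e₃ e₄)
... | false | false | true | true | false = ⊥-elim (triangle 2F e₂ e₃ e₀)
... | false | false | true | true | true = ⊥-elim (triangle 2F e₂ e₃ e₀)
... | false | true | false | false | false = ⊥-elim (path 1F e₁ e₃ e₄ e₀)
... | false | true | false | false | true = inj₁ (4F , pointwise e₀ e₁ e₂ e₃ e₄)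
... | false | true | false | true | false = inj₁ (1F , pointwise e₀ e₁ e₂ e₃ e₄)
... | false | true | false | true | true = inj₂ (inj₁ (3F , pointwise e₀ e₁ e₂ e₃ e₄))
... | false | true | true | false | false = ⊥-elim (triangle 1F e₁ e₂ e₄)
... | false | true | true | false | true = inj₂ (inj₁ (1F , pointwise e₀ e₁ e₂ e₃ e₄))
... | false | true | true | true | false = ⊥-elim (triangle 1F e₁ e₂ e₄)
... | false | true | true | true | true = ⊥-elim (triangle 2F e₂ e₃ e₀)
... | true | false | false | false | false = ⊥-elim (path 0F e₀ e₂ e₃ e₄)
... | true | false | false | false | true = ⊥-elim (triangle 4F e₄ e₀ e₂)
... | true | false | false | true | false = inj₁ (3F , pointwise e₀ e₁ e₂ e₃ e₄)
... | true | false | false | true | true = ⊥-elim (triangle 3F e₃ e₄ e₁)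
... | true | false | true | false | false = inj₁ (0F , pointwise e₀ e₁ e₂ e₃ e₄)
... | true | false | true | false | true = inj₂ (inj₁ (4F , pointwise e₀ e₁ e₂ e₃ e₄))
... | true | false | true | true | false = inj₂ (inj₁ (2F , pointwise e₀ e₁ e₂ e₃ e₄))
... | true | false | true | true | true = ⊥-elim (triangle 3F e₃ e₄ e₁)
... | true | true | false | false | false = ⊥-elim (triangle 0F e₀ e₁ e₃)
... | true | true | false | false | true = ⊥-elim (triangle 0F e₀ e₁ e₃)
... | true | true | false | true | false = inj₂ (inj₁ (0F , pointwise e₀ e₁ e₂ e₃ e₄))
... | true | true | false | true | true = ⊥-elim (triangle 4F e₄ e₀ e₂)
... | true | true | true | false | false = ⊥-elim (triangle 0F e₀ e₁ e₃)
... | true | true | true | false | true = ⊥-elim (triangle 0F e₀ e₁ e₃)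
... | true | true | true | true | false = ⊥-elim (triangle 1F e₁ e₂ e₄)
... | true | true | true | true | true = inj₂ (inj₂ (inj₁ (pointwise e₀ e₁ e₂ e₃ e₄)))

Fadj-sym : ∀ u w → Fadj u w ≡ Fadj w u
Fadj-sym (X a) (X b) = C5-sym a b
Fadj-sym (X a) (Y b) = refl
Fadj-sym (Y a) (X b) = refl
Fadj-sym (Y a) (Y b) = C5-sym a b

F-induced : (FV → Bool) → SubgraphF
F-induced keep = record
  { HV     = λ u → keep u ≡ true
  ; HE     = HE′
  ; HE-sym = λ u w → cong₂ _∧_ (Fadj-sym u w) (∧-comm (keep u) (keep w))
  ; HE-sub = λ u w → ∧-conicalˡ (Fadj u w) _
  ; HE-ver = λ u w e → let keep-uw = ∧-conicalʳ (Fadj u w) _ e in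
                       ∧-conicalˡ (keep u) _ keep-uw , ∧-conicalʳ (keep u) _ keep-uw
  }
  where
  HE′ : FV → FV → Bool
  HE′ u w = Fadj u w ∧ keep u ∧ keep w

TwinFree : ∀ {k} → (Fin k → Fin k → Bool) → Set
TwinFree H = ∀ i j → (∀ l → H i l ≡ H j l) → i ≡ j

twin-free? : ∀ {k} (H : Fin k → Fin k → Bool) → Dec (TwinFree H)
twin-free? H = all? λ i → all? λ j → (all? λ l → H i l ≟ᵇ H j l) →-dec (i ≟ᶠ j)

module Induced {n : ℕ} (G : Graph n) where

  E-sym : ∀ {a b c} → E G a b ≡ c → E G b a ≡ c
  E-sym {a} {b} = trans (sym G b a)

  -- Two vertices of H with different neighbourhoods cannot have the same image.
  realisation⇒induced : ∀ {k} {H : Fin k → Fin k → Bool} (f : Fin k → Fin n) →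
    TwinFree H → (∀ i j → E G (f i) (f j) ≡ H i j) → HasInduced G H
  realisation⇒induced f twin-free realises = f , injective , realises
    where
    injective : Injective _≡_ _≡_ f
    injective {i} {j} fi≡fj = twin-free i j λ l →
      trans (≡.sym (realises i l)) (trans (cong (λ z → E G z (f l)) fi≡fj) (realises j l))

  no-P₅ : ¬ HasInduced G P5 → ∀ a₀ a₁ a₂ a₃ a₄ →
    E G a₀ a₁ ≡ true → E G a₀ a₂ ≡ false → E G a₀ a₃ ≡ false → E G a₀ a₄ ≡ false →
    E G a₁ a₂ ≡ true → E G a₁ a₃ ≡ false → E G a₁ a₄ ≡ false →
    E G a₂ a₃ ≡ true → E G a₂ a₄ ≡ false → E G a₃ a₄ ≡ true → ⊥
  no-P₅ P5-free a₀ a₁ a₂ a₃ a₄ h₀₁ h₀₂ h₀₃ h₀₄ h₁₂ h₁₃ h₁₄ h₂₃ h₂₄ h₃₄ =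
    P5-free (realisation⇒induced a (from-yes (twin-free? P5)) realises)
    where
    a : Fin 5 → Fin n
    a = λ { 0F → a₀ ; 1F → a₁ ; 2F → a₂ ; 3F → a₃ ; 4F → a₄ }
    realises : ∀ i j → E G (a i) (a j) ≡ P5 i j
    realises 0F 0F = irrefl G a₀
    realises 0F 1F = h₀₁
    realises 0F 2F = h₀₂
    realises 0F 3F = h₀₃
    realises 0F 4F = h₀₄
    realises 1F 0F = E-sym h₀₁
    realises 1F 1F = irrefl G a₁
    realises 1F 2F = h₁₂
    realises 1F 3F = h₁₃
    realises 1F 4F = h₁₄
    realises 2F 0F = E-sym h₀₂
    realises 2F 1F = E-sym h₁₂
    realises 2F 2F = irrefl G a₂
    realises 2F 3F = h₂₃
    realises 2F 4F = h₂₄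
    realises 3F 0F = E-sym h₀₃
    realises 3F 1F = E-sym h₁₃
    realises 3F 2F = E-sym h₂₃
    realises 3F 3F = irrefl G a₃
    realises 3F 4F = h₃₄
    realises 4F 0F = E-sym h₀₄
    realises 4F 1F = E-sym h₁₄
    realises 4F 2F = E-sym h₂₄
    realises 4F 3F = E-sym h₃₄
    realises 4F 4F = irrefl G a₄

  no-K₁∪K₃ : ¬ HasInduced G K1∪K3 → ∀ a₀ a₁ a₂ a₃ →
    E G a₀ a₁ ≡ false → E G a₀ a₂ ≡ false → E G a₀ a₃ ≡ false →
    E G a₁ a₂ ≡ true → E G a₁ a₃ ≡ true → E G a₂ a₃ ≡ true → ⊥
  no-K₁∪K₃ K-free a₀ a₁ a₂ a₃ h₀₁ h₀₂ h₀₃ h₁₂ h₁₃ h₂₃ =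
    K-free (realisation⇒induced a (from-yes (twin-free? K1∪K3)) realises)
    where
    a : Fin 4 → Fin n
    a = λ { 0F → a₀ ; 1F → a₁ ; 2F → a₂ ; 3F → a₃ }
    realises : ∀ i j → E G (a i) (a j) ≡ K1∪K3 i j
    realises 0F 0F = irrefl G a₀
    realises 0F 1F = h₀₁
    realises 0F 2F = h₀₂
    realises 0F 3F = h₀₃
    realises 1F 0F = E-sym h₀₁
    realises 1F 1F = irrefl G a₁
    realises 1F 2F = h₁₂
    realises 1F 3F = h₁₃
    realises 2F 0F = E-sym h₀₂
    realises 2F 1F = E-sym h₁₂
    realises 2F 2F = irrefl G a₂
    realises 2F 3F = h₂₃
    realises 3F 0F = E-sym h₀₃
    realises 3F 1F = E-sym h₁₃
    realises 3F 2F = E-sym h₂₃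
    realises 3F 3F = irrefl G a₃

  triangle-dominates : ¬ HasInduced G K1∪K3 → ∀ {a b c x} →
    E G a b ≡ true → E G c a ≡ true → E G c b ≡ true →
    E G x a ≡ false → E G x b ≡ false → E G x c ≡ true
  triangle-dominates K-free {a} {b} {c} {x} ab ca cb xa xb =
    ¬-not λ xc → no-K₁∪K₃ K-free x a b c xa xb xc ab (E-sym ca) (E-sym cb)

module Traces {n : ℕ} (G : Graph n) where

  Trace : Hole G → Fin n → Fin 5 → Bool
  Trace C x a = E G x (v C a)

  rebase : Hole G → Fin 5 → Hole G
  rebase C i = record
    { v     = λ a → v C (i ⊞ a)
    ; v-inj = λ e → ⊞-injective i (v-inj C e)
    ; v-ind = λ a b → trans (v-ind C (i ⊞ a) (i ⊞ b)) (C5-equivariant i a b)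
    }

  rebase-trace : ∀ {P} → Equivariant P → ∀ C i {k x} →
    Trace C x ≗ P (i ⊞ k) → Trace (rebase C i) x ≗ P k
  rebase-trace P-equivariant C i {k} px a = trans (px (i ⊞ a)) (P-equivariant i k a)

  traces-agree : ∀ C {x} {P Q : Fin 5 → Bool} → Trace C x ≗ P → Trace C x ≗ Q → P ≗ Q
  traces-agree C px qx a = trans (≡.sym (px a)) (qx a)

  M⇒anticomplete : ∀ C {m} → InM C m → Trace C m ≗ const false
  M⇒anticomplete C (m∉C , m∉N) a = ¬-not λ e → m∉N (m∉C , a , e)

  blowup-of-F-induced : ∀ {S : Fin n → Set} {keep : FV → Bool} (φ : ∀ x → S x → FV) →
    (∀ x s → keep (φ x s) ≡ true) → (∀ u → keep u ≡ true → ∃[ x ] Σ (S x) λ s → φ x s ≡ u) →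
    (∀ x y s t → E G x y ≡ Fadj (φ x s) (φ y t)) →
    IsBlowUpOf G S (HV (F-induced keep)) (HE (F-induced keep))
  blowup-of-F-induced {keep = keep} φ image-kept preimage edges = φ , image-kept , preimage , edges′
    where
    edges′ : ∀ x y s t → E G x y ≡ Fadj (φ x s) (φ y t) ∧ keep (φ x s) ∧ keep (φ y t)
    edges′ x y s t rewrite image-kept x s | image-kept y t =
      trans (edges x y s t) (≡.sym (∧-identityʳ _))

  -- Rotating C reduces a statement about two traces to one where the first is based at v_0.
  wlog-pair : ∀ {P Q R} → Equivariant P → Equivariant Q → Equivariant R → ∀ {m x y} →
    (∀ D k → Trace D m ≗ const false → Trace D x ≗ P 0F → Trace D y ≗ Q k → E G x y ≡ R 0F k) →
    ∀ C i j → Trace C m ≗ const false → Trace C x ≗ P i → Trace C y ≗ Q j → E G x y ≡ R i j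
  wlog-pair P-eq Q-eq R-eq at-0 C i j pm px py with offset i j
  ... | k , refl =
    trans (at-0 (rebase C i) k (pm ∘ (i ⊞_)) (rebase-trace P-eq C i px) (rebase-trace Q-eq C i py))
          (≡.sym (R-eq i 0F k))

module FiveHole {n : ℕ} (G : Graph n)
  (P5-free : ¬ HasInduced G P5) (K-free : ¬ HasInduced G K1∪K3) where

  open Induced G
  open Traces G

  triangle-rule : ∀ (D : Hole G) {x} →
    E G x (v D 0F) ≡ true → E G x (v D 1F) ≡ true → E G x (v D 3F) ≡ false → ⊥
  triangle-rule D {x} x₀ x₁ x₃ =
    no-K₁∪K₃ K-free (v D 3F) (v D 0F) (v D 1F) x
      (v-ind D 3F 0F) (v-ind D 3F 1F) (E-sym x₃) (v-ind D 0F 1F) (E-sym x₀) (E-sym x₁)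

  path-rule : ∀ (D : Hole G) {x} → E G x (v D 0F) ≡ true →
    E G x (v D 2F) ≡ false → E G x (v D 3F) ≡ false → E G x (v D 4F) ≡ false → ⊥
  path-rule D {x} x₀ x₂ x₃ x₄ =
    no-P₅ P5-free (v D 2F) (v D 3F) (v D 4F) (v D 0F) x
      (v-ind D 2F 3F) (v-ind D 2F 4F) (v-ind D 2F 0F) (E-sym x₂)
      (v-ind D 3F 4F) (v-ind D 3F 0F) (E-sym x₃) (v-ind D 4F 0F) (E-sym x₄) (E-sym x₀)

  vertex-shape : ∀ (C : Hole G) x → Shape (Trace C x)
  vertex-shape C x =
    trace-shape (Trace C x) (λ i → triangle-rule (rebase C i)) (λ i → path-rule (rebase C i))

  no-T₃ : ∀ (C : Hole G) {x i} → ¬ (Trace C x ≗ T₃ i)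
  no-T₃ C {x} {i} px = triangle-rule (rebase C i) (px′ 0F) (px′ 1F) (px′ 3F)
    where
    px′ : Trace (rebase C i) x ≗ T₃ 0F
    px′ = rebase-trace T₃-equivariant C i px

  blind-to-edge⇒adjacent : ∀ (C : Hole G) i {x y} →
    E G x (v C i) ≡ false → E G x (v C (i ⊕ 1)) ≡ false →
    E G y (v C i) ≡ true → E G y (v C (i ⊕ 1)) ≡ true → E G x y ≡ true
  blind-to-edge⇒adjacent C i x₀ x₁ y₀ y₁ =
    triangle-dominates K-free (v-ind (rebase C i) 0F 1F) y₀ y₁ x₀ x₁

  M-N₂-anticomplete : ∀ (C : Hole G) {m x i} →
    Trace C m ≗ const false → Trace C x ≗ T₂ i → E G m x ≡ false
  M-N₂-anticomplete C {m} {x} {i} pm px =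
    at-0 (rebase C i) (pm ∘ (i ⊞_)) (rebase-trace T₂-equivariant C i px)
    where
    at-0 : ∀ (D : Hole G) → Trace D m ≗ const false → Trace D x ≗ T₂ 0F → E G m x ≡ false
    at-0 D pm px = ¬-not λ mx →
      no-P₅ P5-free (v D 3F) (v D 4F) (v D 0F) x m
        (v-ind D 3F 4F) (v-ind D 3F 0F) (E-sym (px 3F)) (E-sym (pm 3F))
        (v-ind D 4F 0F) (E-sym (px 4F)) (E-sym (pm 4F)) (E-sym (px 0F)) (E-sym (pm 0F)) (E-sym mx)

  M-N₃-complete : ∀ (C : Hole G) {m z i} →
    Trace C m ≗ const false → Trace C z ≗ T₃′ i → E G m z ≡ true
  M-N₃-complete C {z = z} {i} pm pz =
    blind-to-edge⇒adjacent C i (pm i) (pm (i ⊕ 1)) (pz′ 0F) (pz′ 1F)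
    where
    pz′ : Trace (rebase C i) z ≗ T₃′ 0F
    pz′ = rebase-trace T₃′-equivariant C i pz

  M-N₅-complete : ∀ (C : Hole G) {m y} →
    Trace C m ≗ const false → Trace C y ≗ const true → E G m y ≡ true
  M-N₅-complete C pm py = blind-to-edge⇒adjacent C 0F (pm 0F) (pm 1F) (py 0F) (py 1F)

  N₂-N₅-complete : ∀ (C : Hole G) {x y i} →
    Trace C x ≗ T₂ i → Trace C y ≗ const true → E G x y ≡ true
  N₂-N₅-complete C {x} {i = i} px py =
    blind-to-edge⇒adjacent C (i ⊕ 3) (px′ 3F) (px′ 4F) (py (i ⊕ 3)) (py (i ⊕ 4))
    where
    px′ : Trace (rebase C i) x ≗ T₂ 0F
    px′ = rebase-trace T₂-equivariant C i px

  M-M-anticomplete : ∀ (C : Hole G) {m m′ z i} →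
    Trace C m ≗ const false → Trace C m′ ≗ const false → Trace C z ≗ T₃′ i → E G m m′ ≡ false
  M-M-anticomplete C {m} {m′} {z} {i} pm pm′ pz = ¬-not λ mm′ →
    no-K₁∪K₃ K-free (v C (i ⊕ 2)) m m′ z
      (E-sym (pm (i ⊕ 2))) (E-sym (pm′ (i ⊕ 2))) (E-sym (pz′ 2F))
      mm′ (M-N₃-complete C pm pz) (M-N₃-complete C pm′ pz)
    where
    pz′ : Trace (rebase C i) z ≗ T₃′ 0F
    pz′ = rebase-trace T₃′-equivariant C i pz

  module AtZero (D : Hole G) {m} (pm : Trace D m ≗ const false) where

    d : Fin 5 → Fin n
    d = v D

    c : ∀ a b → E G (d a) (d b) ≡ C5 a b
    c = v-ind D

    N₂-N₂ : ∀ {x y} k → Trace D x ≗ T₂ 0F → Trace D y ≗ T₂ k → E G x y ≡ C5 1F (k ⊕ 1)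
    N₂-N₂ {x} {y} 0F px py = ¬-not λ e →
      no-K₁∪K₃ K-free (d 3F) (d 0F) x y
        (c 3F 0F) (E-sym (px 3F)) (E-sym (py 3F)) (E-sym (px 0F)) (E-sym (py 0F)) e
    N₂-N₂ {x} {y} 1F px py = ¬-not λ e →
      no-P₅ P5-free (d 0F) x (d 2F) (d 3F) y
        (E-sym (px 0F)) (c 0F 2F) (c 0F 3F) (E-sym (py 0F)) (px 2F) (px 3F) e
        (c 2F 3F) (E-sym (py 2F)) (E-sym (py 3F))
    N₂-N₂ {x} {y} 2F px py = ¬-not λ e →
      no-K₁∪K₃ K-free m (d 2F) x y
        (pm 2F) (M-N₂-anticomplete D pm px) (M-N₂-anticomplete D pm py)
        (E-sym (px 2F)) (E-sym (py 2F)) e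
    N₂-N₂ {x} {y} 3F px py = ¬-not λ e →
      no-K₁∪K₃ K-free m (d 0F) x y
        (pm 0F) (M-N₂-anticomplete D pm px) (M-N₂-anticomplete D pm py)
        (E-sym (px 0F)) (E-sym (py 0F)) e
    N₂-N₂ {x} {y} 4F px py = ¬-not λ e →
      no-P₅ P5-free (d 2F) x (d 0F) (d 4F) y
        (E-sym (px 2F)) (c 2F 0F) (c 2F 4F) (E-sym (py 2F)) (px 0F) (px 4F) e
        (c 0F 4F) (E-sym (py 0F)) (E-sym (py 4F))

    N₃-N₂ : ∀ {x y} k → Trace D x ≗ T₃′ 0F → Trace D y ≗ T₂ k → E G x y ≡ Fadj (Y 1F) (X (k ⊕ 1))
    N₃-N₂ {x} {y} 0F px py = ¬-not λ e →
      no-P₅ P5-free (d 2F) y (d 0F) x m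
        (E-sym (py 2F)) (c 2F 0F) (E-sym (px 2F)) (E-sym (pm 2F)) (py 0F) (E-sym e)
        (E-sym (M-N₂-anticomplete D pm py)) (E-sym (px 0F)) (E-sym (pm 0F))
        (E-sym (M-N₃-complete D pm px))
    N₃-N₂ {x} {y} 1F px py = ¬-not λ e →
      no-K₁∪K₃ K-free (d 4F) (d 1F) x y
        (c 4F 1F) (E-sym (px 4F)) (E-sym (py 4F)) (E-sym (px 1F)) (E-sym (py 1F)) e
    N₃-N₂ {x} {y} 2F px py = ¬-not λ e →
      no-P₅ P5-free (d 0F) x (d 3F) (d 2F) y
        (E-sym (px 0F)) (c 0F 3F) (c 0F 2F) (E-sym (py 0F)) (px 3F) (px 2F) e
        (c 3F 2F) (E-sym (py 3F)) (E-sym (py 2F))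
    N₃-N₂ {x} {y} 3F px py = ¬-not λ e →
      no-K₁∪K₃ K-free (d 2F) (d 0F) x y
        (c 2F 0F) (E-sym (px 2F)) (E-sym (py 2F)) (E-sym (px 0F)) (E-sym (py 0F)) e
    N₃-N₂ {x} {y} 4F px py = ¬-not λ e →
      no-P₅ P5-free (d 4F) y (d 1F) x m
        (E-sym (py 4F)) (c 4F 1F) (E-sym (px 4F)) (E-sym (pm 4F)) (py 1F) (E-sym e)
        (E-sym (M-N₂-anticomplete D pm py)) (E-sym (px 1F)) (E-sym (pm 1F))
        (E-sym (M-N₃-complete D pm px))

    N₃-N₃ : ∀ {x y} k → Trace D x ≗ T₃′ 0F → Trace D y ≗ T₃′ k → E G x y ≡ C5 1F (k ⊕ 1)
    N₃-N₃ {x} {y} 0F px py = ¬-not λ e →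
      no-K₁∪K₃ K-free (d 2F) (d 0F) x y
        (c 2F 0F) (E-sym (px 2F)) (E-sym (py 2F)) (E-sym (px 0F)) (E-sym (py 0F)) e
    N₃-N₃ {x} {y} 1F px py = ¬-not λ e →
      no-P₅ P5-free (d 0F) x (d 3F) (d 2F) y
        (E-sym (px 0F)) (c 0F 3F) (c 0F 2F) (E-sym (py 0F)) (px 3F) (px 2F) e
        (c 3F 2F) (E-sym (py 3F)) (E-sym (py 2F))
    N₃-N₃ {x} {y} 2F px py = ¬-not λ e →
      no-K₁∪K₃ K-free (d 4F) m x y
        (E-sym (pm 4F)) (E-sym (px 4F)) (E-sym (py 4F))
        (M-N₃-complete D pm px) (M-N₃-complete D pm py) e
    N₃-N₃ {x} {y} 3F px py = ¬-not λ e →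
      no-K₁∪K₃ K-free (d 2F) m x y
        (E-sym (pm 2F)) (E-sym (px 2F)) (E-sym (py 2F))
        (M-N₃-complete D pm px) (M-N₃-complete D pm py) e
    N₃-N₃ {x} {y} 4F px py = ¬-not λ e →
      no-P₅ P5-free (d 1F) x (d 3F) (d 4F) y
        (E-sym (px 1F)) (c 1F 3F) (c 1F 4F) (E-sym (py 1F)) (px 3F) (px 4F) e
        (c 3F 4F) (E-sym (py 3F)) (E-sym (py 4F))

  N₂-N₂-adjacency : ∀ {m x y} (C : Hole G) i j → Trace C m ≗ const false →
    Trace C x ≗ T₂ i → Trace C y ≗ T₂ j → E G x y ≡ C5 (i ⊕ 1) (j ⊕ 1)
  N₂-N₂-adjacency = wlog-pair T₂-equivariant T₂-equivariant shifted-C5-equivariant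
    λ D k pm → AtZero.N₂-N₂ D pm k

  N₃-N₂-adjacency : ∀ {m x y} (C : Hole G) i j → Trace C m ≗ const false →
    Trace C x ≗ T₃′ i → Trace C y ≗ T₂ j → E G x y ≡ Fadj (Y (i ⊕ 1)) (X (j ⊕ 1))
  N₃-N₂-adjacency = wlog-pair T₃′-equivariant T₂-equivariant shifted-F-equivariant
    λ D k pm → AtZero.N₃-N₂ D pm k

  N₃-N₃-adjacency : ∀ {m x y} (C : Hole G) i j → Trace C m ≗ const false →
    Trace C x ≗ T₃′ i → Trace C y ≗ T₃′ j → E G x y ≡ C5 (i ⊕ 1) (j ⊕ 1)
  N₃-N₃-adjacency = wlog-pair T₃′-equivariant T₃′-equivariant shifted-C5-equivariant
    λ D k pm → AtZero.N₃-N₃ D pm k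

  classify-outside : ∀ (C : Hole G) {x} → ¬ InC C x → Shape (Trace C x) →
    InN2 C x ⊎ InN3 C x ⊎ InN5 C x ⊎ InM C x
  classify-outside C x∉C (inj₁ (i , px)) =
    inj₁ (i , (x∉C , i , rebase-trace T₂-equivariant C i {0F} px 0F) , px)
  classify-outside C x∉C (inj₂ (inj₁ (i , px))) =
    inj₂ (inj₁ (i , inj₂ ((x∉C , i , rebase-trace T₃′-equivariant C i {0F} px 0F) , px)))
  classify-outside C x∉C (inj₂ (inj₂ (inj₁ px))) = inj₂ (inj₂ (inj₁ ((x∉C , 0F , px 0F) , px)))
  classify-outside C x∉C (inj₂ (inj₂ (inj₂ px))) =
    inj₂ (inj₂ (inj₂ (x∉C , λ { (_ , a , e) → not-¬ e (px a) })))

  partition : ∀ (C : Hole G) →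
    Partition4 (λ x → InC C x ⊎ InN2 C x) (InN3 C) (InN5 C) (InM C)
  partition C = record
    { cover  = cover
    ; disjAB = disjAB
    ; disjAC = disjAC
    ; disjAD = disjAD
    ; disjBC = disjBC
    ; disjBD = disjBD
    ; disjCD = λ { x (x∈N , _) (_ , x∉N) → x∉N x∈N }
    }
    where
    cover : ∀ x → (InC C x ⊎ InN2 C x) ⊎ InN3 C x ⊎ InN5 C x ⊎ InM C x
    cover x = case any? (λ i → v C i ≟ᶠ x) of λ where
      (yes x∈C) → inj₁ (inj₁ x∈C)
      (no x∉C)  → map₁ inj₂ (classify-outside C x∉C (vertex-shape C x))

    disjAB : ∀ x → InC C x ⊎ InN2 C x → InN3 C x → ⊥
    disjAB x (inj₁ x∈C) (_ , inj₁ ((x∉C , _) , _)) = x∉C x∈C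
    disjAB x (inj₁ x∈C) (_ , inj₂ ((x∉C , _) , _)) = x∉C x∈C
    disjAB x (inj₂ _) (_ , inj₁ (_ , py)) = no-T₃ C py
    disjAB x (inj₂ (i , _ , px)) (j , inj₂ (_ , py)) = T₂-T₃′-disjoint i j (traces-agree C px py)

    disjAC : ∀ x → InC C x ⊎ InN2 C x → InN5 C x → ⊥
    disjAC x (inj₁ x∈C) ((x∉C , _) , _) = x∉C x∈C
    disjAC x (inj₂ (i , _ , px)) (_ , py) = T₂-complete-disjoint i 0F (traces-agree C px py)

    disjAD : ∀ x → InC C x ⊎ InN2 C x → InM C x → ⊥
    disjAD x (inj₁ x∈C) (x∉C , _) = x∉C x∈C
    disjAD x (inj₂ (_ , x∈N , _)) (_ , x∉N) = x∉N x∈N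

    disjBC : ∀ x → InN3 C x → InN5 C x → ⊥
    disjBC x (_ , inj₁ (_ , px)) _ = no-T₃ C px
    disjBC x (i , inj₂ (_ , px)) (_ , py) = T₃′-complete-disjoint i 0F (traces-agree C px py)

    disjBD : ∀ x → InN3 C x → InM C x → ⊥
    disjBD x (_ , inj₁ (x∈N , _)) (_ , x∉N) = x∉N x∈N
    disjBD x (_ , inj₂ (x∈N , _)) (_ , x∉N) = x∉N x∈N

  module Blowups (C : Hole G) {m} (m∈M : InM C m) where

    pm : Trace C m ≗ const false
    pm = M⇒anticomplete C m∈M

    ψ : ∀ x → InC C x ⊎ InN2 C x → Fin 5
    ψ x (inj₁ (i , _)) = i
    ψ x (inj₂ (i , _)) = i ⊕ 1

    C5-edges : ∀ x y s t → E G x y ≡ C5 (ψ x s) (ψ y t)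
    C5-edges x y (inj₁ (i , refl)) (inj₁ (j , refl)) = v-ind C i j
    C5-edges x y (inj₁ (i , refl)) (inj₂ (j , _ , py)) =
      trans (E-sym (py i)) (trans (T₂-row j i) (C5-sym (j ⊕ 1) i))
    C5-edges x y (inj₂ (i , _ , px)) (inj₁ (j , refl)) = trans (px j) (T₂-row i j)
    C5-edges x y (inj₂ (i , _ , px)) (inj₂ (j , _ , py)) = N₂-N₂-adjacency C i j pm px py

    φ : ∀ x → InC C x ⊎ InN2 C x ⊎ InN3 C x → FV
    φ x (inj₁ s) = X (ψ x (inj₁ s))
    φ x (inj₂ (inj₁ s)) = X (ψ x (inj₂ s))
    φ x (inj₂ (inj₂ (i , _))) = Y (i ⊕ 1)

    F-edges : ∀ x y s t → E G x y ≡ Fadj (φ x s) (φ y t)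
    F-edges x y (inj₂ (inj₂ (_ , inj₁ (_ , px)))) t = ⊥-elim (no-T₃ C px)
    F-edges x y s (inj₂ (inj₂ (_ , inj₁ (_ , py)))) = ⊥-elim (no-T₃ C py)
    F-edges x y (inj₁ s) (inj₁ t) = C5-edges x y (inj₁ s) (inj₁ t)
    F-edges x y (inj₁ s) (inj₂ (inj₁ t)) = C5-edges x y (inj₁ s) (inj₂ t)
    F-edges x y (inj₂ (inj₁ s)) (inj₁ t) = C5-edges x y (inj₂ s) (inj₁ t)
    F-edges x y (inj₂ (inj₁ s)) (inj₂ (inj₁ t)) = C5-edges x y (inj₂ s) (inj₂ t)
    F-edges x y (inj₁ (i , refl)) (inj₂ (inj₂ (j , inj₂ (_ , py)))) =
      trans (E-sym (py i)) (T₃′-row j i)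
    F-edges x y (inj₂ (inj₂ (i , inj₂ (_ , px)))) (inj₁ (j , refl)) = trans (px j) (T₃′-row i j)
    F-edges x y (inj₂ (inj₁ (i , _ , px))) (inj₂ (inj₂ (j , inj₂ (_ , py)))) =
      E-sym (N₃-N₂-adjacency C j i pm py px)
    F-edges x y (inj₂ (inj₂ (i , inj₂ (_ , px)))) (inj₂ (inj₁ (j , _ , py))) =
      N₃-N₂-adjacency C i j pm px py
    F-edges x y (inj₂ (inj₂ (i , inj₂ (_ , px)))) (inj₂ (inj₂ (j , inj₂ (_ , py)))) =
      N₃-N₃-adjacency C i j pm px py

    -- Only the y_b with nonempty class are kept, so that every vertex of the subgraph of 𝓕
    -- has a preimage.
    Occupied : Fin 5 → Set
    Occupied b = ∃[ x ] ∃[ j ] j ⊕ 1 ≡ b × Trace C x ≗ T₃′ j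

    occupied? : ∀ b → Dec (Occupied b)
    occupied? b = any? λ x → any? λ j → (j ⊕ 1 ≟ᶠ b) ×-dec all? λ a → E G x (v C a) ≟ᵇ T₃′ j a

    keep : FV → Bool
    keep (X _) = true
    keep (Y b) = does (occupied? b)

    φ-kept : ∀ x s → keep (φ x s) ≡ true
    φ-kept x (inj₁ _) = refl
    φ-kept x (inj₂ (inj₁ _)) = refl
    φ-kept x (inj₂ (inj₂ (_ , inj₁ (_ , px)))) = ⊥-elim (no-T₃ C px)
    φ-kept x (inj₂ (inj₂ (j , inj₂ (_ , px)))) = dec-true (occupied? (j ⊕ 1)) (x , j , refl , px)

    occupied-has-preimage : ∀ b (o : Dec (Occupied b)) → does o ≡ true →
      ∃[ x ] Σ (InC C x ⊎ InN2 C x ⊎ InN3 C x) λ s → φ x s ≡ Y b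
    occupied-has-preimage b (no _) ()
    occupied-has-preimage b (yes (x , j , j⊕1≡b , px)) _ =
      x , inj₂ (inj₂ (j , inj₂ ((x∉C , j , rebase-trace T₃′-equivariant C j {0F} px 0F) , px))) ,
      cong Y j⊕1≡b
      where
      x∉C : ¬ InC C x
      x∉C (a , refl) = C5-T₃′-disjoint a j (traces-agree C (v-ind C a) px)

    kept-has-preimage : ∀ u → keep u ≡ true →
      ∃[ x ] Σ (InC C x ⊎ InN2 C x ⊎ InN3 C x) λ s → φ x s ≡ u
    kept-has-preimage (X a) _ = v C a , inj₁ (a , refl) , refl
    kept-has-preimage (Y b) h = occupied-has-preimage b (occupied? b) h

    blowup-C5 : IsBlowUpOfC5 G (λ x → InC C x ⊎ InN2 C x)
    blowup-C5 = ψ , (λ _ _ → tt) , (λ u _ → v C u , inj₁ (u , refl) , refl) , C5-edges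

    blowup-F : IsBlowUpOfSubgraphOfF G (λ x → InC C x ⊎ InN2 C x ⊎ InN3 C x)
    blowup-F = F-induced keep , blowup-of-F-induced φ φ-kept kept-has-preimage F-edges

  M∪C∪N₂-complete-to-N₅ : ∀ (C : Hole G) x y →
    InM C x ⊎ InC C x ⊎ InN2 C x → InN5 C y → E G x y ≡ true
  M∪C∪N₂-complete-to-N₅ C x y (inj₁ x∈M) (_ , py) = M-N₅-complete C (M⇒anticomplete C x∈M) py
  M∪C∪N₂-complete-to-N₅ C x y (inj₂ (inj₁ (i , refl))) (_ , py) = E-sym (py i)
  M∪C∪N₂-complete-to-N₅ C x y (inj₂ (inj₂ (_ , _ , px))) (_ , py) = N₂-N₅-complete C px py

  M-anticomplete-to-C∪N₂ : ∀ (C : Hole G) x y → InM C x → InC C y ⊎ InN2 C y → E G x y ≡ false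
  M-anticomplete-to-C∪N₂ C x y x∈M (inj₁ (j , refl)) = M⇒anticomplete C x∈M j
  M-anticomplete-to-C∪N₂ C x y x∈M (inj₂ (_ , _ , py)) =
    M-N₂-anticomplete C (M⇒anticomplete C x∈M) py

  M-complete-to-N₃ : ∀ (C : Hole G) x y → InM C x → InN3 C y → E G x y ≡ true
  M-complete-to-N₃ C x y x∈M (_ , inj₁ (_ , py)) = ⊥-elim (no-T₃ C py)
  M-complete-to-N₃ C x y x∈M (_ , inj₂ (_ , py)) = M-N₃-complete C (M⇒anticomplete C x∈M) py

  M-independent : ∀ (C : Hole G) → (∃ λ z → InN3 C z) →
    ∀ x y → InM C x → InM C y → E G x y ≡ false
  M-independent C (_ , _ , inj₁ (_ , pz)) x y _ _ = ⊥-elim (no-T₃ C pz)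
  M-independent C (_ , _ , inj₂ (_ , pz)) x y x∈M y∈M =
    M-M-anticomplete C (M⇒anticomplete C x∈M) (M⇒anticomplete C y∈M) pz

theorem1p3 : ∀ (n : ℕ) (G : Graph n) →
    Connected G →
    ¬ HasInduced G P5 →
    ¬ HasInduced G K1∪K3 →
    (∃ λ (C : Hole G) → NonDominating C) →
    ∀ (C : Hole G) → NonDominating C →
      Partition4 (λ x → InC C x ⊎ InN2 C x) (InN3 C) (InN5 C) (InM C)
      × IsBlowUpOfC5 G (λ x → InC C x ⊎ InN2 C x)
      × IsBlowUpOfSubgraphOfF G (λ x → InC C x ⊎ InN2 C x ⊎ InN3 C x)
      × (∀ x y → (InM C x ⊎ InC C x ⊎ InN2 C x) → InN5 C y → E G x y ≡ true)
      × (∀ x y → InM C x → (InC C y ⊎ InN2 C y) → E G x y ≡ false)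
      × (∀ x y → InM C x → InN3 C y → E G x y ≡ true)
      × ((∃ λ z → InN3 C z) → ∀ x y → InM C x → InM C y → E G x y ≡ false)
theorem1p3 n G _ P5-free K-free _ C (_ , m∈M) =
    partition C , blowup-C5 , blowup-F
  , M∪C∪N₂-complete-to-N₅ C , M-anticomplete-to-C∪N₂ C , M-complete-to-N₃ C , M-independent C
  where
  open FiveHole G P5-free K-free
  open Blowups C m∈M
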